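{- Let $A$ be a finite set with $n=|A|$, let $a_1,a_2\in A$ be distinct, and put $A'=A\setminus\{a_1,a_2\}$. For each $i\in\{1,2\}$ let $\mathcal D_i$ be a maximal ASPD on $A\setminus\{a_i\}$ such that $a_{3-i}$ is a bottom alternative of $\mathcal D_i$. For $\{i,j\}=\{1,2\}$ let $\mathcal D_{ij}=\{\omega_{A'}:\omega\in\mathcal D_i,\ \omega(n-1)=a_j\}$, and assume $\mathcal D_{12}=\mathcal D_{21}$. Then: (1) for every 3-element $T\subseteq A'$ and every $x\in T$, $x$ is not a bottom alternative of $(\mathcal D_1)_T$ if and only if $x$ is not a bottom alternative of $(\mathcal D_2)_T$; (2) the domain $\mathcal D=\{\omega\in\mathcal L(A):\ \omega(n)=a_1,\ \omega_{A\setminus\{a_1\}}\in\mathcal D_1\}\cup\{\omega\in\mathcal L(A):\ \omega(n)=a_2,\ \omega_{A\setminus\{a_2\}}\in\mathcal D_2\}$ is a maximal ASPD on $A$.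
   Context: For a finite set $X$ with $m$ elements, a preference on $X$ is a bijection $\omega\colon[m]\to X$, written $\omega(1)\cdots\omega(m)$ ($\omega(1)$ most preferred); $\mathcal L(X)$ is the set of preferences; a domain is a subset of $\mathcal L(X)$. For $S\subseteq X$, $\omega_S$ is the preference on $S$ listing its elements in their $\omega$-order, and $\mathcal D_S=\{\omega_S:\omega\in\mathcal D\}$. An alternative $x$ is a bottom alternative of $\mathcal D$ if $\omega(m)=x$ for some $\omega\in\mathcal D$. $\mathcal D$ is an ASPD if for every 3-element $T\subseteq X$ some $x\in T$ is not a bottom alternative of $\mathcal D_T$; maximal if not properly contained in another ASPD in $\mathcal L(X)$. (Preferences in $\mathcal D_i$ have length $n-1$, so $\omega(n-1)$ is the last entry.) -}

module Defs where

open import Level using (Level; 0ℓ) renaming (suc to lsuc)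
open import Data.Nat using (ℕ)
open import Data.Fin using (Fin)
open import Data.Fin.Subset using (Subset; _∈_; _∉_; _⊆_; ∣_∣; ⊤; _-_)
open import Data.Fin.Subset.Properties using (_∈?_)
open import Data.List using (List; filter; last)
open import Data.Maybe using (just)
open import Data.Product using (Σ; ∃; _×_)
open import Data.Sum using (_⊎_)
open import Data.List.Relation.Unary.Unique.Propositional using (Unique)
import Data.List.Membership.Propositional as LM
open import Relation.Binary.PropositionalEquality using (_≡_)
open import Relation.Nullary using (¬_)
open import Function.Bundles using (_⇔_)

-- Alternatives are elements of Fin n; a set of alternatives X is a Subset n.
-- A (candidate) preference is a list of alternatives, first = most preferred.
Pref : ℕ → Set
Pref n = List (Fin n)

IsPrefOn : {n : ℕ} → Subset n → Pref n → Set
IsPrefOn X ω = Unique ω × (∀ x → (x ∈ X) ⇔ (x LM.∈ ω))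

Domain : ℕ → Set₁
Domain n = Pref n → Set

_⊆D_ : {n : ℕ} → Domain n → Domain n → Set
D ⊆D D' = ∀ ω → D ω → D' ω

DomainOn : {n : ℕ} → Subset n → Domain n → Set
DomainOn X D = ∀ ω → D ω → IsPrefOn X ω

restrict : {n : ℕ} → Subset n → Pref n → Pref n
restrict S ω = filter (λ x → x ∈? S) ω

restrictD : {n : ℕ} → Subset n → Domain n → Domain n
restrictD S D ω' = Σ _ (λ ω → D ω × (ω' ≡ restrict S ω))

IsBottom : {n : ℕ} → Domain n → Fin n → Set
IsBottom D x = Σ _ (λ ω → D ω × (last ω ≡ just x))

IsASPD : {n : ℕ} → Subset n → Domain n → Set
IsASPD {n} X D = DomainOn X D ×
  ((T : Subset n) → T ⊆ X → ∣ T ∣ ≡ 3 →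
     Σ (Fin n) (λ x → x ∈ T × ¬ IsBottom (restrictD T D) x))

IsMaximalASPD : {n : ℕ} → Subset n → Domain n → Set₁
IsMaximalASPD {n} X D = IsASPD X D ×
  ((D' : Domain n) → IsASPD X D' → D ⊆D D' → D' ⊆D D)

Dij : {n : ℕ} → Subset n → Domain n → Fin n → Domain n
Dij A' Di aj ω' = Σ _ (λ ω → Di ω × (last ω ≡ just aj) × (ω' ≡ restrict A' ω))

-- the glued domain 𝓓 on A (= ⊤)
glue : {n : ℕ} → Fin n → Fin n → Domain n → Domain n → Domain n
glue {n} a₁ a₂ D₁ D₂ ω =
  (IsPrefOn ⊤ ω × last ω ≡ just a₁ × D₁ (restrict (⊤ - a₁) ω)) ⊎
  (IsPrefOn ⊤ ω × last ω ≡ just a₂ × D₂ (restrict (⊤ - a₂) ω))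

{-# OPTIONS --safe #-}
module Submission where

-- In a maximal ASPD D on X, if b is a bottom alternative of D, then moving b to the end of any
-- preference of D gives again a preference of D: the new preference creates no new bottom on
-- any triple. Hence, on triples T ⊆ A', the bottoms of D₁ are those of D₁₂ and the bottoms of
-- D₂ are those of D₂₁, which gives (1). For (2), on a triple containing a₁ and a₂ the third
-- alternative is never at the bottom of the glued domain; a triple containing only a₁ inherits
-- the condition from D₂, where a₁ is already a bottom (symmetrically for a₂); a triple avoiding
-- both inherits it from D₁, by (1) for the preferences coming from D₂. For maximality, take a
-- preference ω of an ASPD extension: if ω ends in aᵢ, maximality of Dᵢ puts its restriction
-- into Dᵢ; if it ends in some other c, then every element of {a₁, a₂, c} is a bottom.

open import Defs
open import Level using (0ℓ)
open import Data.Nat using (ℕ; suc; _≤_; s≤s)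
open import Data.Fin using (Fin; _≟_)
open import Data.Fin.Properties using (any?)
open import Data.Fin.Subset using (Subset; _∈_; _∉_; _⊆_; ∣_∣; ⊤; _─_; _-_; _∪_; ⁅_⁆; inside; outside)
open import Data.Fin.Subset.Properties
  using (_∈?_; ∈⊤; p─q⊆p; x∈p∧x≢y⇒x∈p-y; p─x─y≡p─y─x; ∪-identityˡ; ⊆-refl; x∈p∪q⁺; x∈p∪q⁻;
         x∈⁅x⁆; x∈⁅y⁆⇒x≡y; ∣⁅x⁆∣≡1; p⊆q⇒∣p∣≤∣q∣)
open import Data.Vec.Base using (_∷_; here; there)
open import Data.List using ([]; _∷_; [_]; _∷ʳ_; last)
open import Data.List.Properties using (filter-all)
open import Data.List.Relation.Unary.All using ([]; tabulate)
open import Data.List.Relation.Unary.Any using (here; there)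
import Data.List.Membership.Propositional as LM
open import Data.List.Membership.Propositional.Properties
  using (∈-filter⁺; ∈-filter⁻; ∈-++⁺ˡ; ∈-++⁺ʳ; ∈-++⁻)
import Data.List.Relation.Unary.Unique.Propositional.Properties as Unique
open import Data.List.Relation.Unary.AllPairs using ([]; _∷_)
open import Data.Maybe using (just)
open import Data.Maybe.Properties using (just-injective)
open import Data.Product using (Σ; ∃; _×_; _,_; proj₁; proj₂)
open import Data.Sum using (_⊎_; inj₁; inj₂; [_,_]′)
import Data.Sum as Sum
open import Function using (_∘_)
open import Function.Bundles using (_⇔_; mk⇔; Equivalence)
open import Relation.Binary.PropositionalEquality
  using (_≡_; _≢_; refl; sym; trans; cong; subst; module ≡-Reasoning)
open import Relation.Nullary using (¬_; yes; no; contradiction)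
open import Relation.Nullary.Decidable using (_×-dec_; ¬?)
import Relation.Unary as U
open import Relation.Unary using (Pred; ｛_｝; _≐_; Satisfiable)
open import Relation.Unary.Properties using (≐-sym; ≐-trans)

variable
  n : ℕ
  X Y T : Subset n
  D D' D₁ D₂ : Domain n
  ω ρ : Pref n
  a b c x a₁ a₂ : Fin n

x∈p─q⇒x∉q : ∀ (p q : Subset n) → x ∈ p ─ q → x ∉ q
x∈p─q⇒x∉q (_ ∷ p) (inside  ∷ q) ()        here
x∈p─q⇒x∉q (_ ∷ p) (outside ∷ q) (there m) (there m') = x∈p─q⇒x∉q p q m m'
x∈p─q⇒x∉q (_ ∷ p) (inside  ∷ q) (there m) (there m') = x∈p─q⇒x∉q p q m m'

x∉p-x : ∀ {p : Subset n} → x ∉ p - x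
x∉p-x {x = x} {p} x∈p-x = x∈p─q⇒x∉q p ⁅ x ⁆ x∈p-x (x∈⁅x⁆ x)

p⊆q∧x∉p⇒p⊆q-x : T ⊆ X → b ∉ T → T ⊆ X - b
p⊆q∧x∉p⇒p⊆q-x {T = T} T⊆X b∉T y∈T = x∈p∧x≢y⇒x∈p-y (T⊆X y∈T) (λ { refl → b∉T y∈T })

p⊆q-x⇒x∉p : T ⊆ X - b → b ∉ T
p⊆q-x⇒x∉p T⊆X-b = x∉p-x ∘ T⊆X-b

x∉p⇒∣⁅x⁆∪p∣≡1+∣p∣ : ∀ (p : Subset n) → x ∉ p → ∣ ⁅ x ⁆ ∪ p ∣ ≡ suc ∣ p ∣
x∉p⇒∣⁅x⁆∪p∣≡1+∣p∣ {x = Fin.zero}  (inside  ∷ p) x∉p = contradiction here x∉p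
x∉p⇒∣⁅x⁆∪p∣≡1+∣p∣ {x = Fin.zero}  (outside ∷ p) x∉p = cong (suc ∘ ∣_∣) (∪-identityˡ p)
x∉p⇒∣⁅x⁆∪p∣≡1+∣p∣ {x = Fin.suc x} (inside  ∷ p) x∉p = cong suc (x∉p⇒∣⁅x⁆∪p∣≡1+∣p∣ p (x∉p ∘ there))
x∉p⇒∣⁅x⁆∪p∣≡1+∣p∣ {x = Fin.suc x} (outside ∷ p) x∉p = x∉p⇒∣⁅x⁆∪p∣≡1+∣p∣ p (x∉p ∘ there)

x∈⁅a⁆∪⁅b⁆∪⁅c⁆⁻ : x ∈ ⁅ a ⁆ ∪ ⁅ b ⁆ ∪ ⁅ c ⁆ → x ≡ a ⊎ x ≡ b ⊎ x ≡ c
x∈⁅a⁆∪⁅b⁆∪⁅c⁆⁻ {a = a} {b} {c} x∈abc with x∈p∪q⁻ ⁅ a ⁆ (⁅ b ⁆ ∪ ⁅ c ⁆) x∈abc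
... | inj₁ x∈a  = inj₁ (x∈⁅y⁆⇒x≡y a x∈a)
... | inj₂ x∈bc = inj₂ (Sum.map (x∈⁅y⁆⇒x≡y b) (x∈⁅y⁆⇒x≡y c) (x∈p∪q⁻ ⁅ b ⁆ ⁅ c ⁆ x∈bc))

∣⁅a⁆∪⁅b⁆∪⁅c⁆∣≡3 : a ≢ b → a ≢ c → b ≢ c → ∣ ⁅ a ⁆ ∪ ⁅ b ⁆ ∪ ⁅ c ⁆ ∣ ≡ 3
∣⁅a⁆∪⁅b⁆∪⁅c⁆∣≡3 {a = a} {b} {c} a≢b a≢c b≢c = begin
  ∣ ⁅ a ⁆ ∪ ⁅ b ⁆ ∪ ⁅ c ⁆ ∣  ≡⟨ x∉p⇒∣⁅x⁆∪p∣≡1+∣p∣ (⁅ b ⁆ ∪ ⁅ c ⁆) a∉bc ⟩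
  suc ∣ ⁅ b ⁆ ∪ ⁅ c ⁆ ∣      ≡⟨ cong suc (x∉p⇒∣⁅x⁆∪p∣≡1+∣p∣ ⁅ c ⁆ (b≢c ∘ x∈⁅y⁆⇒x≡y c)) ⟩
  suc (suc ∣ ⁅ c ⁆ ∣)        ≡⟨ cong (suc ∘ suc) (∣⁅x⁆∣≡1 c) ⟩
  3                          ∎
  where
  open ≡-Reasoning
  a∉bc : a ∉ ⁅ b ⁆ ∪ ⁅ c ⁆
  a∉bc = [ a≢b ∘ x∈⁅y⁆⇒x≡y b , a≢c ∘ x∈⁅y⁆⇒x≡y c ]′ ∘ x∈p∪q⁻ ⁅ b ⁆ ⁅ c ⁆

∣p∣≡3⇒∃-other : ∀ (p : Subset n) → ∣ p ∣ ≡ 3 → a ≢ b → ∃ λ y → y ∈ p × y ≢ a × y ≢ b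
∣p∣≡3⇒∃-other {a = a} {b} p ∣p∣≡3 a≢b with any? (λ y → y ∈? p ×-dec ¬? (y ≟ a) ×-dec ¬? (y ≟ b))
... | yes other = other
... | no ¬other = contradiction (subst (_≤ 2) ∣p∣≡3 ∣p∣≤2) λ { (s≤s (s≤s ())) }
  where
  p⊆ab : p ⊆ ⁅ a ⁆ ∪ ⁅ b ⁆
  p⊆ab {y} y∈p with y ≟ a | y ≟ b
  ... | yes refl | _        = x∈p∪q⁺ (inj₁ (x∈⁅x⁆ y))
  ... | no _     | yes refl = x∈p∪q⁺ (inj₂ (x∈⁅x⁆ y))
  ... | no y≢a   | no y≢b   = contradiction (y , y∈p , y≢a , y≢b) ¬other
  ∣⁅a⁆∪⁅b⁆∣≡2 : ∣ ⁅ a ⁆ ∪ ⁅ b ⁆ ∣ ≡ 2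
  ∣⁅a⁆∪⁅b⁆∣≡2 = trans (x∉p⇒∣⁅x⁆∪p∣≡1+∣p∣ ⁅ b ⁆ (a≢b ∘ x∈⁅y⁆⇒x≡y b)) (cong suc (∣⁅x⁆∣≡1 b))
  ∣p∣≤2 : ∣ p ∣ ≤ 2
  ∣p∣≤2 = subst (∣ p ∣ ≤_) ∣⁅a⁆∪⁅b⁆∣≡2 (p⊆q⇒∣p∣≤∣q∣ p⊆ab)

restrict-restrict : T ⊆ X → ∀ ω → restrict T (restrict X ω) ≡ restrict T ω
restrict-restrict T⊆X [] = refl
restrict-restrict {T = T} {X = X} T⊆X (y ∷ ω) with y ∈? X
... | yes _ with y ∈? T
...   | yes _ = cong (y ∷_) (restrict-restrict T⊆X ω)
...   | no _  = restrict-restrict T⊆X ω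
restrict-restrict {T = T} {X = X} T⊆X (y ∷ ω) | no y∉X with y ∈? T
...   | yes y∈T = contradiction (T⊆X y∈T) y∉X
...   | no _    = restrict-restrict T⊆X ω

restrict-∷ʳ-∉ : b ∉ T → ∀ ρ → restrict T (ρ ∷ʳ b) ≡ restrict T ρ
restrict-∷ʳ-∉ {b = b} {T = T} b∉T [] with b ∈? T
... | yes b∈T = contradiction b∈T b∉T
... | no _    = refl
restrict-∷ʳ-∉ {T = T} b∉T (y ∷ ρ) with y ∈? T
... | yes _ = cong (y ∷_) (restrict-∷ʳ-∉ b∉T ρ)
... | no _  = restrict-∷ʳ-∉ b∉T ρ

restrict-id : (∀ {y} → y LM.∈ ω → y ∈ X) → restrict X ω ≡ ω
restrict-id {X = X} ω⊆X = filter-all (_∈? X) (tabulate ω⊆X)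

restrict-∷ʳ-restrict : T ⊆ X - b → ∀ ρ → restrict T (restrict (X - b) ρ ∷ʳ b) ≡ restrict T ρ
restrict-∷ʳ-restrict {X = X} {b = b} T⊆X-b ρ =
  trans (restrict-∷ʳ-∉ (p⊆q-x⇒x∉p T⊆X-b) (restrict (X - b) ρ)) (restrict-restrict T⊆X-b ρ)

last-∷ʳ : ∀ (ρ : Pref n) b → last (ρ ∷ʳ b) ≡ just b
last-∷ʳ []          b = refl
last-∷ʳ (_ ∷ [])     b = refl
last-∷ʳ (_ ∷ y ∷ ρ) b = last-∷ʳ (y ∷ ρ) b

last-∷ : ∀ y {ρ : Pref n} → last ρ ≡ just b → last (y ∷ ρ) ≡ just b
last-∷ _ {_ ∷ _} last≡b = last≡b

last-restrict : ∀ ω → last ω ≡ just b → b ∈ T → last (restrict T ω) ≡ just b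
last-restrict {T = T} (y ∷ []) refl b∈T with y ∈? T
... | yes _   = refl
... | no  b∉T = contradiction b∈T b∉T
last-restrict {T = T} (y ∷ z ∷ ω) last≡b b∈T with last-restrict (z ∷ ω) last≡b b∈T | y ∈? T
... | ih | yes _ = last-∷ y {restrict T (z ∷ ω)} ih
... | ih | no _  = ih

last-restrict-unique : ∀ ω → last ω ≡ just b → b ∈ T → last (restrict T ω) ≡ just x → x ≡ b
last-restrict-unique ω last≡b b∈T last≡x =
  just-injective (trans (sym last≡x) (last-restrict ω last≡b b∈T))

∈⇒∃-last : x LM.∈ ω → ∃ λ c → last ω ≡ just c
∈⇒∃-last {ω = y ∷ []}    _ = y , refl
∈⇒∃-last {ω = _ ∷ z ∷ ω} _ = ∈⇒∃-last {ω = z ∷ ω} (here refl)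

IsPrefOn-restrict : IsPrefOn X ω → T ⊆ X → IsPrefOn T (restrict T ω)
IsPrefOn-restrict {ω = ω} {T = T} (unique , ∈X⇔∈ω) T⊆X =
  Unique.filter⁺ (_∈? T) unique ,
  λ y → mk⇔ (λ y∈T → ∈-filter⁺ (_∈? T) (Equivalence.to (∈X⇔∈ω y) (T⊆X y∈T)) y∈T)
            (proj₂ ∘ ∈-filter⁻ (_∈? T) {xs = ω})

IsPrefOn-∷ʳ : IsPrefOn (X - b) ρ → b ∈ X → IsPrefOn X (ρ ∷ʳ b)
IsPrefOn-∷ʳ {X = X} {b = b} {ρ = ρ} (unique , ∈X-b⇔∈ρ) b∈X =
  Unique.++⁺ unique ([] ∷ []) b∉ρ , λ y → mk⇔ (∈X⇒∈ρb y) (∈ρb⇒∈X y)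
  where
  b∉ρ : ∀ {y} → ¬ (y LM.∈ ρ × y LM.∈ [ b ])
  b∉ρ (b∈ρ , here refl) = x∉p-x (Equivalence.from (∈X-b⇔∈ρ b) b∈ρ)
  ∈X⇒∈ρb : ∀ y → y ∈ X → y LM.∈ ρ ∷ʳ b
  ∈X⇒∈ρb y y∈X with y ≟ b
  ... | yes refl = ∈-++⁺ʳ ρ (here refl)
  ... | no y≢b   = ∈-++⁺ˡ (Equivalence.to (∈X-b⇔∈ρ y) (x∈p∧x≢y⇒x∈p-y y∈X y≢b))
  ∈ρb⇒∈X : ∀ y → y LM.∈ ρ ∷ʳ b → y ∈ X
  ∈ρb⇒∈X y y∈ρb with ∈-++⁻ ρ y∈ρb
  ... | inj₁ y∈ρ       = p─q⊆p X ⁅ b ⁆ (Equivalence.from (∈X-b⇔∈ρ y) y∈ρ)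
  ... | inj₂ (here refl) = b∈X

BottomsOn : Subset n → Domain n → Pred (Fin n) 0ℓ
BottomsOn T D = IsBottom (restrictD T D)

NeverBottomIn : Subset n → Domain n → Set
NeverBottomIn {n} T D = Σ (Fin n) λ x → x ∈ T × ¬ BottomsOn T D x

bottomsOn-intro : D ω → last (restrict T ω) ≡ just x → BottomsOn T D x
bottomsOn-intro {ω = ω} d last≡x = _ , (ω , d , refl) , last≡x

IsBottom⇒BottomsOn : IsBottom D x → x ∈ T → BottomsOn T D x
IsBottom⇒BottomsOn (ω , d , last≡x) x∈T = bottomsOn-intro d (last-restrict ω last≡x x∈T)

bottomsOn-mono : (∀ {ω} → D ω → restrictD T D' (restrict T ω)) → BottomsOn T D U.⊆ BottomsOn T D'
bottomsOn-mono D⊆D' (_ , (_ , d , refl) , last≡x) = _ , D⊆D' d , last≡x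

bottomsOn-∪⁻ : BottomsOn T (D U.∪ D') x → BottomsOn T D x ⊎ BottomsOn T D' x
bottomsOn-∪⁻ (_ , (_ , inj₁ d , refl) , last≡x) = inj₁ (bottomsOn-intro d last≡x)
bottomsOn-∪⁻ (_ , (_ , inj₂ d , refl) , last≡x) = inj₂ (bottomsOn-intro d last≡x)

bottomsOn-｛｝ : BottomsOn T ｛ ω ｝ x → last (restrict T ω) ≡ just x
bottomsOn-｛｝ (_ , (_ , refl , refl) , last≡x) = last≡x

neverBottomIn-anti : BottomsOn T D U.⊆ BottomsOn T D' → NeverBottomIn T D' → NeverBottomIn T D
neverBottomIn-anti D⊆D' (x , x∈T , ¬bottom) = x , x∈T , ¬bottom ∘ D⊆D'

IsASPD-fromBottoms : X ⊆ Y → DomainOn X D → IsASPD Y D' →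
  (∀ {T} → T ⊆ X → BottomsOn T D U.⊆ BottomsOn T D') → IsASPD X D
IsASPD-fromBottoms X⊆Y dom (_ , neverBottom) D⊆D' =
  dom , λ T T⊆X ∣T∣≡3 → neverBottomIn-anti (D⊆D' T⊆X) (neverBottom T (X⊆Y ∘ T⊆X) ∣T∣≡3)

three-bottoms⇒¬IsASPD : a ≢ b → a ≢ c → b ≢ c → a ∈ X → b ∈ X → c ∈ X →
  IsBottom D a → IsBottom D b → IsBottom D c → ¬ IsASPD X D
three-bottoms⇒¬IsASPD {a = a} {b} {c} {X} {D} a≢b a≢c b≢c a∈X b∈X c∈X bottom-a bottom-b bottom-c
                      (_ , neverBottom) =
  everyBottom (neverBottom abc (∈abc-elim a∈X b∈X c∈X) (∣⁅a⁆∪⁅b⁆∪⁅c⁆∣≡3 a≢b a≢c b≢c))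
  where
  abc : Subset _
  abc = ⁅ a ⁆ ∪ ⁅ b ⁆ ∪ ⁅ c ⁆
  ∈abc-elim : ∀ {P : Fin _ → Set} → P a → P b → P c → ∀ {x} → x ∈ abc → P x
  ∈abc-elim Pa Pb Pc = [ (λ { refl → Pa }) , [ (λ { refl → Pb }) , (λ { refl → Pc }) ]′ ]′ ∘ x∈⁅a⁆∪⁅b⁆∪⁅c⁆⁻
  everyBottom : ¬ NeverBottomIn abc D
  everyBottom (x , x∈abc , ¬bottom) =
    ¬bottom (IsBottom⇒BottomsOn (∈abc-elim bottom-a bottom-b bottom-c x∈abc) x∈abc)

maximal-absorbs : IsMaximalASPD X D → IsPrefOn X ω → X ⊆ Y → IsASPD Y D' →
  (∀ {T} → T ⊆ X → BottomsOn T (D U.∪ ｛ ω ｝) U.⊆ BottomsOn T D') → D ω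
maximal-absorbs {X = X} {D = D} {ω = ω} ((dom , _) , maximal) ω-pref X⊆Y aspd bottoms =
  maximal _ (IsASPD-fromBottoms X⊆Y dom-∪ aspd bottoms) (λ _ → inj₁) ω (inj₂ refl)
  where
  dom-∪ : DomainOn X (D U.∪ ｛ ω ｝)
  dom-∪ ρ (inj₁ d)    = dom ρ d
  dom-∪ _ (inj₂ refl) = ω-pref

moveToBottom : IsMaximalASPD X D → IsBottom D b → b ∈ X → D ρ → D (restrict (X - b) ρ ∷ʳ b)
moveToBottom {X = X} {D = D} {b = b} {ρ = ρ} M bottom-b b∈X dρ =
  maximal-absorbs M ρ*-pref ⊆-refl (proj₁ M) bottoms
  where
  ρ* : Pref _
  ρ* = restrict (X - b) ρ ∷ʳ b
  ρ*-pref : IsPrefOn X ρ*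
  ρ*-pref = IsPrefOn-∷ʳ (IsPrefOn-restrict (proj₁ (proj₁ M) ρ dρ) (p─q⊆p X ⁅ b ⁆)) b∈X
  bottoms : ∀ {T} → T ⊆ X → BottomsOn T (D U.∪ ｛ ρ* ｝) U.⊆ BottomsOn T D
  bottoms {T} T⊆X {x} bottom with bottomsOn-∪⁻ bottom | b ∈? T
  ... | inj₁ bottom-D  | _       = bottom-D
  ... | inj₂ bottom-ρ* | yes b∈T = subst (BottomsOn T D) (sym x≡b) (IsBottom⇒BottomsOn bottom-b b∈T)
    where
    x≡b : x ≡ b
    x≡b = last-restrict-unique ρ* (last-∷ʳ (restrict (X - b) ρ) b) b∈T (bottomsOn-｛｝ bottom-ρ*)
  ... | inj₂ bottom-ρ* | no b∉T  = bottomsOn-intro dρ (trans (cong last (sym same)) (bottomsOn-｛｝ bottom-ρ*))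
    where
    same : restrict T ρ* ≡ restrict T ρ
    same = restrict-∷ʳ-restrict {X = X} (p⊆q∧x∉p⇒p⊆q-x T⊆X b∉T) ρ

bottomsOn-Dij : IsMaximalASPD X D → IsBottom D b → b ∈ X → T ⊆ Y → T ⊆ X - b →
  BottomsOn T D ≐ BottomsOn T (Dij Y D b)
bottomsOn-Dij {X = X} {D = D} {b = b} {T = T} {Y = Y} M bottom-b b∈X T⊆Y T⊆X-b =
  bottomsOn-mono moved , bottomsOn-mono forget
  where
  moved : ∀ {ρ} → D ρ → restrictD T (Dij Y D b) (restrict T ρ)
  moved {ρ} dρ =
    restrict Y ρ* , (ρ* , moveToBottom M bottom-b b∈X dρ , last-∷ʳ (restrict (X - b) ρ) b , refl) , (begin
    restrict T ρ                ≡⟨ restrict-∷ʳ-restrict T⊆X-b ρ ⟨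
    restrict T ρ*               ≡⟨ restrict-restrict T⊆Y ρ* ⟨
    restrict T (restrict Y ρ*)  ∎)
    where
    open ≡-Reasoning
    ρ* : Pref _
    ρ* = restrict (X - b) ρ ∷ʳ b
  forget : ∀ {ω} → Dij Y D b ω → restrictD T D (restrict T ω)
  forget (ω , dω , _ , refl) = ω , dω , restrict-restrict T⊆Y ω

bottomsOn-cong : (∀ ω → D ω ⇔ D' ω) → BottomsOn T D ≐ BottomsOn T D'
bottomsOn-cong D⇔D' =
  bottomsOn-mono (λ {ω} d → ω , Equivalence.to (D⇔D' ω) d , refl) ,
  bottomsOn-mono (λ {ω} d → ω , Equivalence.from (D⇔D' ω) d , refl)

restrict-∈-maximal : IsMaximalASPD (X - a) D → IsASPD X D' → (∀ {ρ} → D ρ → D' (ρ ∷ʳ a)) →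
  D' ω → D (restrict (X - a) ω)
restrict-∈-maximal {X = X} {a = a} {D = D} {D' = D'} {ω = ω} M aspd D∷ʳa⊆D' dω =
  maximal-absorbs M (IsPrefOn-restrict (proj₁ aspd ω dω) X-a⊆X) X-a⊆X aspd bottoms
  where
  X-a⊆X : X - a ⊆ X
  X-a⊆X = p─q⊆p X ⁅ a ⁆
  bottoms : ∀ {T} → T ⊆ X - a → BottomsOn T (D U.∪ ｛ restrict (X - a) ω ｝) U.⊆ BottomsOn T D'
  bottoms {T} T⊆X-a = bottomsOn-mono sameRestriction
    where
    sameRestriction : ∀ {ρ} → (D U.∪ ｛ restrict (X - a) ω ｝) ρ → restrictD T D' (restrict T ρ)
    sameRestriction {ρ} (inj₁ dρ) = ρ ∷ʳ a , D∷ʳa⊆D' dρ , sym (restrict-∷ʳ-∉ (p⊆q-x⇒x∉p T⊆X-a) ρ)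
    sameRestriction (inj₂ refl)   = ω , dω , restrict-restrict T⊆X-a ω

-- glue a₁ a₂ D₁ D₂ is, definitionally, WithBottom a₁ D₁ U.∪ WithBottom a₂ D₂.
WithBottom : Fin n → Domain n → Domain n
WithBottom a D ω = IsPrefOn ⊤ ω × last ω ≡ just a × D (restrict (⊤ - a) ω)

WithBottom-∷ʳ : DomainOn (⊤ - a) D → D ρ → WithBottom a D (ρ ∷ʳ a)
WithBottom-∷ʳ {a = a} {D = D} {ρ = ρ} dom dρ =
  IsPrefOn-∷ʳ (dom ρ dρ) ∈⊤ , last-∷ʳ ρ a , subst D (sym restrict≡ρ) dρ
  where
  restrict≡ρ : restrict (⊤ - a) (ρ ∷ʳ a) ≡ ρ
  restrict≡ρ = trans (restrict-∷ʳ-∉ x∉p-x ρ)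
                     (restrict-id (λ {y} → Equivalence.from (proj₂ (dom ρ dρ) y)))

bottomsOn-WithBottom-∈ : a ∈ T → BottomsOn T (WithBottom a D) x → x ≡ a
bottomsOn-WithBottom-∈ a∈T (_ , (ω , (_ , last≡a , _) , refl) , last≡x) =
  last-restrict-unique ω last≡a a∈T last≡x

bottomsOn-WithBottom-∉ : a ∉ T → BottomsOn T (WithBottom a D) U.⊆ BottomsOn T D
bottomsOn-WithBottom-∉ {a = a} a∉T = bottomsOn-mono λ {ω} (_ , _ , d) →
  restrict (⊤ - a) ω , d , sym (restrict-restrict (p⊆q∧x∉p⇒p⊆q-x (λ _ → ∈⊤) a∉T) ω)

bottomsOn-WithBottom-⊆ : a ∈ T → IsBottom D a → BottomsOn T (WithBottom a D') U.⊆ BottomsOn T D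
bottomsOn-WithBottom-⊆ {T = T} {D = D} {D' = D'} a∈T bottom-a bottom =
  subst (BottomsOn T D) (sym (bottomsOn-WithBottom-∈ {D = D'} a∈T bottom)) (IsBottom⇒BottomsOn bottom-a a∈T)

glue-isASPD : a₁ ≢ a₂ → IsASPD (⊤ - a₁) D₁ → IsBottom D₁ a₂ → IsASPD (⊤ - a₂) D₂ → IsBottom D₂ a₁ →
  (∀ {T} → T ⊆ ⊤ - a₁ - a₂ → BottomsOn T D₂ U.⊆ BottomsOn T D₁) → IsASPD ⊤ (glue a₁ a₂ D₁ D₂)
glue-isASPD {a₁ = a₁} {a₂} {D₁} {D₂} a₁≢a₂ (_ , neverBottom₁) bottom₁ (_ , neverBottom₂) bottom₂ D₂⊆D₁ =
  (λ _ → [ proj₁ , proj₁ ]′) , neverBottom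
  where
  bottomsOn-glue⁻ : ∀ {T x} → BottomsOn T (glue a₁ a₂ D₁ D₂) x →
    BottomsOn T (WithBottom a₁ D₁) x ⊎ BottomsOn T (WithBottom a₂ D₂) x
  bottomsOn-glue⁻ = bottomsOn-∪⁻
  bottomsOn-glue-⊆ : ∀ {T D} →
    BottomsOn T (WithBottom a₁ D₁) U.⊆ BottomsOn T D → BottomsOn T (WithBottom a₂ D₂) U.⊆ BottomsOn T D →
    BottomsOn T (glue a₁ a₂ D₁ D₂) U.⊆ BottomsOn T D
  bottomsOn-glue-⊆ ⊆₁ ⊆₂ bottom = [ ⊆₁ , ⊆₂ ]′ (bottomsOn-glue⁻ bottom)
  ⊆⊤- : ∀ {T a} → a ∉ T → T ⊆ ⊤ - a
  ⊆⊤- = p⊆q∧x∉p⇒p⊆q-x (λ _ → ∈⊤)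
  neverBottom : ∀ T → T ⊆ ⊤ → ∣ T ∣ ≡ 3 → NeverBottomIn T (glue a₁ a₂ D₁ D₂)
  neverBottom T _ ∣T∣≡3 with a₁ ∈? T | a₂ ∈? T
  ... | yes a₁∈T | yes a₂∈T =
    let y , y∈T , y≢a₁ , y≢a₂ = ∣p∣≡3⇒∃-other T ∣T∣≡3 a₁≢a₂ in
    y , y∈T , [ y≢a₁ ∘ bottomsOn-WithBottom-∈ {D = D₁} a₁∈T
              , y≢a₂ ∘ bottomsOn-WithBottom-∈ {D = D₂} a₂∈T ]′ ∘ bottomsOn-glue⁻
  ... | yes a₁∈T | no a₂∉T = neverBottomIn-anti
    (bottomsOn-glue-⊆ (bottomsOn-WithBottom-⊆ {D' = D₁} a₁∈T bottom₂) (bottomsOn-WithBottom-∉ a₂∉T))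
    (neverBottom₂ T (⊆⊤- a₂∉T) ∣T∣≡3)
  ... | no a₁∉T | yes a₂∈T = neverBottomIn-anti
    (bottomsOn-glue-⊆ (bottomsOn-WithBottom-∉ a₁∉T) (bottomsOn-WithBottom-⊆ {D' = D₂} a₂∈T bottom₁))
    (neverBottom₁ T (⊆⊤- a₁∉T) ∣T∣≡3)
  ... | no a₁∉T | no a₂∉T = neverBottomIn-anti
    (bottomsOn-glue-⊆ (bottomsOn-WithBottom-∉ a₁∉T)
                      (D₂⊆D₁ (p⊆q∧x∉p⇒p⊆q-x (⊆⊤- a₁∉T) a₂∉T) ∘ bottomsOn-WithBottom-∉ a₂∉T))
    (neverBottom₁ T (⊆⊤- a₁∉T) ∣T∣≡3)

glue-isMaximal : a₁ ≢ a₂ → IsMaximalASPD (⊤ - a₁) D₁ → Satisfiable D₁ →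
  IsMaximalASPD (⊤ - a₂) D₂ → Satisfiable D₂ →
  (D' : Domain n) → IsASPD ⊤ D' → glue a₁ a₂ D₁ D₂ ⊆D D' → D' ⊆D glue a₁ a₂ D₁ D₂
glue-isMaximal {a₁ = a₁} {a₂} {D₁} {D₂} a₁≢a₂ M₁ (ρ₁ , d₁) M₂ (ρ₂ , d₂) D' aspd glue⊆D' ω dω =
  classify (∈⇒∃-last (Equivalence.to (proj₂ ω-pref a₁) ∈⊤))
  where
  ω-pref : IsPrefOn ⊤ ω
  ω-pref = proj₁ aspd ω dω
  D₁∷ʳa₁⊆D' : ∀ {ρ} → D₁ ρ → D' (ρ ∷ʳ a₁)
  D₁∷ʳa₁⊆D' d = glue⊆D' _ (inj₁ (WithBottom-∷ʳ (proj₁ (proj₁ M₁)) d))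
  D₂∷ʳa₂⊆D' : ∀ {ρ} → D₂ ρ → D' (ρ ∷ʳ a₂)
  D₂∷ʳa₂⊆D' d = glue⊆D' _ (inj₂ (WithBottom-∷ʳ (proj₁ (proj₁ M₂)) d))
  classify : (∃ λ c → last ω ≡ just c) → glue a₁ a₂ D₁ D₂ ω
  classify (c , last≡c) with c ≟ a₁ | c ≟ a₂
  ... | yes refl | _        = inj₁ (ω-pref , last≡c , restrict-∈-maximal M₁ aspd D₁∷ʳa₁⊆D' dω)
  ... | no _     | yes refl = inj₂ (ω-pref , last≡c , restrict-∈-maximal M₂ aspd D₂∷ʳa₂⊆D' dω)
  ... | no c≢a₁  | no c≢a₂  = contradiction aspd
    (three-bottoms⇒¬IsASPD a₁≢a₂ (c≢a₁ ∘ sym) (c≢a₂ ∘ sym) ∈⊤ ∈⊤ ∈⊤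
      (ρ₁ ∷ʳ a₁ , D₁∷ʳa₁⊆D' d₁ , last-∷ʳ ρ₁ a₁)
      (ρ₂ ∷ʳ a₂ , D₂∷ʳa₂⊆D' d₂ , last-∷ʳ ρ₂ a₂)
      (ω , dω , last≡c))

bottomsOn-agree : a₁ ≢ a₂ → IsMaximalASPD (⊤ - a₁) D₁ → IsBottom D₁ a₂ →
  IsMaximalASPD (⊤ - a₂) D₂ → IsBottom D₂ a₁ →
  (∀ ω → Dij (⊤ - a₁ - a₂) D₁ a₂ ω ⇔ Dij (⊤ - a₁ - a₂) D₂ a₁ ω) →
  T ⊆ ⊤ - a₁ - a₂ → BottomsOn T D₁ ≐ BottomsOn T D₂
bottomsOn-agree {a₁ = a₁} {a₂} {T = T} a₁≢a₂ M₁ bottom₁ M₂ bottom₂ D₁₂⇔D₂₁ T⊆A' =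
  ≐-trans (bottomsOn-Dij M₁ bottom₁ (x∈p∧x≢y⇒x∈p-y ∈⊤ (a₁≢a₂ ∘ sym)) T⊆A' T⊆A') (
  ≐-trans (bottomsOn-cong D₁₂⇔D₂₁) (
  ≐-sym (bottomsOn-Dij M₂ bottom₂ (x∈p∧x≢y⇒x∈p-y ∈⊤ a₁≢a₂) T⊆A'
                       (subst (T ⊆_) (p─x─y≡p─y─x ⊤ a₁ a₂) T⊆A'))))

lemma2p30 : (n : ℕ) (a₁ a₂ : Fin n) → ¬ (a₁ ≡ a₂) →
    (D₁ D₂ : Domain n) →
    IsMaximalASPD (⊤ - a₁) D₁ → IsBottom D₁ a₂ →
    IsMaximalASPD (⊤ - a₂) D₂ → IsBottom D₂ a₁ →
    (∀ ω → Dij ((⊤ - a₁) - a₂) D₁ a₂ ω ⇔ Dij ((⊤ - a₁) - a₂) D₂ a₁ ω) →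
    ((T : Subset n) → T ⊆ ((⊤ - a₁) - a₂) → ∣ T ∣ ≡ 3 → (x : Fin n) → x ∈ T →
        (¬ IsBottom (restrictD T D₁) x) ⇔ (¬ IsBottom (restrictD T D₂) x))
    × IsMaximalASPD ⊤ (glue a₁ a₂ D₁ D₂)
lemma2p30 n a₁ a₂ a₁≢a₂ D₁ D₂ M₁ bottom₁ M₂ bottom₂ D₁₂⇔D₂₁ =
  nonBottoms-agree ,
  (glue-isASPD a₁≢a₂ (proj₁ M₁) bottom₁ (proj₁ M₂) bottom₂ (proj₂ ∘ bottoms-agree) ,
   glue-isMaximal a₁≢a₂ M₁ (nonempty bottom₁) M₂ (nonempty bottom₂))
  where
  bottoms-agree : ∀ {T} → T ⊆ ⊤ - a₁ - a₂ → BottomsOn T D₁ ≐ BottomsOn T D₂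
  bottoms-agree = bottomsOn-agree a₁≢a₂ M₁ bottom₁ M₂ bottom₂ D₁₂⇔D₂₁
  nonBottoms-agree : (T : Subset n) → T ⊆ ⊤ - a₁ - a₂ → ∣ T ∣ ≡ 3 → (x : Fin n) → x ∈ T →
    (¬ BottomsOn T D₁ x) ⇔ (¬ BottomsOn T D₂ x)
  nonBottoms-agree T T⊆A' _ _ _ =
    mk⇔ (λ ¬b₁ b₂ → ¬b₁ (proj₂ (bottoms-agree T⊆A') b₂)) (λ ¬b₂ b₁ → ¬b₂ (proj₁ (bottoms-agree T⊆A') b₁))
  nonempty : ∀ {D y} → IsBottom D y → Satisfiable D
  nonempty (ω , d , _) = ω , d
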